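{- Let $\mathcal{C}$ be a category with finite products and weak equalisers. If every object of $\mathcal{C}$ is a choice object, then $\mathcal{C}$ is elemental.
   Context: A weak equaliser is like an equaliser but without uniqueness of the mediating arrow. An arrow $x\colon 1\to X$ from the terminal object is written $x\in X$. For $f\colon X\to Y$ and $y\in Y$, write $y\in_f$ if there is $x\in X$ with $fx=y$; $f$ is surjective if $y\in_f$ for all $y\in Y$. An object $Y$ is a choice object if every surjection with codomain $Y$ has a section. The category is elemental if its terminal object is a strong generator (every arrow $f\colon X\to Y$ such that for every $y\in Y$ there is a unique $x\in X$ with $fx=y$ is an isomorphism) and separating (any $f,g\colon X\to Y$ with $fx=gx$ for all $x\in X$ are equal). -}

module Defs where

open import Level using (Level; _⊔_) renaming (suc to lsuc)
open import Data.Product using (Σ; _×_; _,_)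
open import Relation.Binary using (IsEquivalence)

record Category (o ℓ e : Level) : Set (lsuc (o ⊔ ℓ ⊔ e)) where
  infix  4 _≈_
  infixr 9 _∘_
  field
    Obj   : Set o
    _⇒_   : Obj → Obj → Set ℓ
    _≈_   : ∀ {A B} → A ⇒ B → A ⇒ B → Set e
    id    : ∀ {A} → A ⇒ A
    _∘_   : ∀ {A B C} → B ⇒ C → A ⇒ B → A ⇒ C
    assoc     : ∀ {A B C D} {f : A ⇒ B} {g : B ⇒ C} {h : C ⇒ D} →
                (h ∘ g) ∘ f ≈ h ∘ (g ∘ f)
    identityˡ : ∀ {A B} {f : A ⇒ B} → id ∘ f ≈ f
    identityʳ : ∀ {A B} {f : A ⇒ B} → f ∘ id ≈ f
    equiv     : ∀ {A B} → IsEquivalence (_≈_ {A} {B})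
    ∘-resp-≈  : ∀ {A B C} {f h : B ⇒ C} {g i : A ⇒ B} →
                f ≈ h → g ≈ i → f ∘ g ≈ h ∘ i

module _ {o ℓ e : Level} (C : Category o ℓ e) where
  open Category C

  record Terminal : Set (o ⊔ ℓ ⊔ e) where
    field
      ⊤        : Obj
      !        : ∀ {A} → A ⇒ ⊤
      !-unique : ∀ {A} (f : A ⇒ ⊤) → ! ≈ f

  record Product (A B : Obj) : Set (o ⊔ ℓ ⊔ e) where
    field
      A×B     : Obj
      π₁      : A×B ⇒ A
      π₂      : A×B ⇒ B
      ⟨_,_⟩   : ∀ {X} → X ⇒ A → X ⇒ B → X ⇒ A×B
      project₁ : ∀ {X} {f : X ⇒ A} {g : X ⇒ B} → π₁ ∘ ⟨ f , g ⟩ ≈ f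
      project₂ : ∀ {X} {f : X ⇒ A} {g : X ⇒ B} → π₂ ∘ ⟨ f , g ⟩ ≈ g
      unique   : ∀ {X} {h : X ⇒ A×B} {f : X ⇒ A} {g : X ⇒ B} →
                 π₁ ∘ h ≈ f → π₂ ∘ h ≈ g → ⟨ f , g ⟩ ≈ h

  record FiniteProducts : Set (o ⊔ ℓ ⊔ e) where
    field
      terminal : Terminal
      product  : ∀ {A B} → Product A B

  record WeakEqualiser {A B : Obj} (f g : A ⇒ B) : Set (o ⊔ ℓ ⊔ e) where
    field
      E        : Obj
      arr      : E ⇒ A
      equality : f ∘ arr ≈ g ∘ arr
      factor   : ∀ {Z} (h : Z ⇒ A) → f ∘ h ≈ g ∘ h →
                 Σ (Z ⇒ E) λ k → arr ∘ k ≈ h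

  WeakEqualisers : Set (o ⊔ ℓ ⊔ e)
  WeakEqualisers = ∀ {A B} (f g : A ⇒ B) → WeakEqualiser f g

  module _ (T : Terminal) where
    open Terminal T

    _∈_ : Obj → Set ℓ
    _∈_ X = ⊤ ⇒ X

    _∈[_] : ∀ {X Y} → ⊤ ⇒ Y → X ⇒ Y → Set (ℓ ⊔ e)
    _∈[_] {X} y f = Σ (⊤ ⇒ X) λ x → f ∘ x ≈ y

    Surjective : ∀ {X Y} → X ⇒ Y → Set (ℓ ⊔ e)
    Surjective {X} {Y} f = (y : ⊤ ⇒ Y) → y ∈[ f ]

    IsChoiceObject : Obj → Set (o ⊔ ℓ ⊔ e)
    IsChoiceObject Y = ∀ {X} (f : X ⇒ Y) → Surjective f →
                       Σ (Y ⇒ X) λ s → f ∘ s ≈ id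

    IsIso : ∀ {X Y} → X ⇒ Y → Set (ℓ ⊔ e)
    IsIso {X} {Y} f = Σ (Y ⇒ X) λ g → (g ∘ f ≈ id) × (f ∘ g ≈ id)

    StrongGenerator : Set (o ⊔ ℓ ⊔ e)
    StrongGenerator = ∀ {X Y} (f : X ⇒ Y) →
      ((y : ⊤ ⇒ Y) → Σ (⊤ ⇒ X) λ x → (f ∘ x ≈ y) ×
                        (∀ (x′ : ⊤ ⇒ X) → f ∘ x′ ≈ y → x′ ≈ x)) →
      IsIso f

    Separating : Set (o ⊔ ℓ ⊔ e)
    Separating = ∀ {X Y} (f g : X ⇒ Y) →
      ((x : ⊤ ⇒ X) → f ∘ x ≈ g ∘ x) → f ≈ g

    Elemental : Set (o ⊔ ℓ ⊔ e)
    Elemental = StrongGenerator × Separating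

module Submission where

-- Proof idea (the terminal object is the only part of the finite products
-- that is needed).
--
-- Separation: given f g : X ⇒ Y agreeing on all global elements, take a weak
-- equaliser e : E ⇒ X of f and g.  Every x ∈ X satisfies f x = g x and so
-- factors through e: the arrow e is surjective.  As X is a choice object, e
-- has a section s, so e is a split epimorphism and f ∘ e ≈ g ∘ e gives f ≈ g.
--
-- Strong generation: if every y ∈ Y has a unique f-preimage, then f is
-- surjective, and as Y is a choice object f has a section s.  By
-- separation, s ∘ f ≈ id follows from s (f x) ≈ x for every x ∈ X, which
-- holds because both are f-preimages of f x.

open import Level using (Level)
open import Data.Product using (Σ; _,_; proj₁; proj₂)
open import Relation.Binary using (Setoid; IsEquivalence)
import Relation.Binary.Reasoning.Setoid as SetoidReasoning
open import Defs

module Elements {o ℓ e : Level} (C : Category o ℓ e) (T : Terminal C) where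
  open Category C
  open Terminal T

  homSetoid : ∀ {A B} → Setoid ℓ e
  homSetoid {A} {B} = record
    { Carrier = A ⇒ B ; _≈_ = _≈_ ; isEquivalence = equiv }

  module HomReasoning {A B : Obj} = SetoidReasoning (homSetoid {A} {B})
  open HomReasoning
  module ≈ {A B : Obj} = IsEquivalence (equiv {A} {B})

  splitEpi-cancelʳ : ∀ {X E Y} {p : E ⇒ X} {s : X ⇒ E} {f g : X ⇒ Y} →
    p ∘ s ≈ id → f ∘ p ≈ g ∘ p → f ≈ g
  splitEpi-cancelʳ {p = p} {s} {f} {g} ps≈id fp≈gp = begin
    f             ≈⟨ ≈.sym identityʳ ⟩
    f ∘ id        ≈⟨ ∘-resp-≈ ≈.refl (≈.sym ps≈id) ⟩
    f ∘ (p ∘ s)   ≈⟨ ≈.sym assoc ⟩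
    (f ∘ p) ∘ s   ≈⟨ ∘-resp-≈ fp≈gp ≈.refl ⟩
    (g ∘ p) ∘ s   ≈⟨ assoc ⟩
    g ∘ (p ∘ s)   ≈⟨ ∘-resp-≈ ≈.refl ps≈id ⟩
    g ∘ id        ≈⟨ identityʳ ⟩
    g             ∎

  weakEqualiser-surjective : ∀ {X Y} {f g : X ⇒ Y} (W : WeakEqualiser C f g) →
    ((x : ⊤ ⇒ X) → f ∘ x ≈ g ∘ x) → Surjective C T (WeakEqualiser.arr W)
  weakEqualiser-surjective W agree x = WeakEqualiser.factor W x (agree x)

  separating : WeakEqualisers C → (∀ Y → IsChoiceObject C T Y) →
    Separating C T
  separating WE choice {X} f g agree =
    splitEpi-cancelʳ (proj₂ section) (WeakEqualiser.equality W)
    where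
    W : WeakEqualiser C f g
    W = WE f g
    section : Σ (X ⇒ WeakEqualiser.E W) λ s → WeakEqualiser.arr W ∘ s ≈ id
    section = choice X (WeakEqualiser.arr W) (weakEqualiser-surjective W agree)

  section-isRetraction : Separating C T → ∀ {X Y} (f : X ⇒ Y) (s : Y ⇒ X) →
    ((y : ⊤ ⇒ Y) (x x′ : ⊤ ⇒ X) → f ∘ x ≈ y → f ∘ x′ ≈ y → x ≈ x′) →
    f ∘ s ≈ id → s ∘ f ≈ id
  section-isRetraction sep f s unique fs≈id = sep (s ∘ f) id λ x → begin
    (s ∘ f) ∘ x   ≈⟨ assoc ⟩
    s ∘ (f ∘ x)   ≈⟨ unique (f ∘ x) _ _ (preimage x) ≈.refl ⟩
    x             ≈⟨ ≈.sym identityˡ ⟩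
    id ∘ x        ∎
    where
    preimage : (x : ⊤ ⇒ _) → f ∘ (s ∘ (f ∘ x)) ≈ f ∘ x
    preimage x = begin
      f ∘ (s ∘ (f ∘ x))   ≈⟨ ≈.sym assoc ⟩
      (f ∘ s) ∘ (f ∘ x)   ≈⟨ ∘-resp-≈ fs≈id ≈.refl ⟩
      id ∘ (f ∘ x)        ≈⟨ identityˡ ⟩
      f ∘ x               ∎

  strongGenerator : Separating C T → (∀ Y → IsChoiceObject C T Y) →
    StrongGenerator C T
  strongGenerator sep choice {X} {Y} f bijective =
    s , section-isRetraction sep f s unique fs≈id , fs≈id
    where
    surjective : Surjective C T f
    surjective y = proj₁ (bijective y) , proj₁ (proj₂ (bijective y))
    unique : (y : ⊤ ⇒ Y) (x x′ : ⊤ ⇒ X) → f ∘ x ≈ y → f ∘ x′ ≈ y → x ≈ x′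
    unique y x x′ fx≈y fx′≈y =
      ≈.trans (proj₂ (proj₂ (bijective y)) x fx≈y)
              (≈.sym (proj₂ (proj₂ (bijective y)) x′ fx′≈y))
    section : Σ (Y ⇒ X) λ s → f ∘ s ≈ id
    section = choice Y f surjective
    s : Y ⇒ X
    s = proj₁ section
    fs≈id : f ∘ s ≈ id
    fs≈id = proj₂ section

lemma3p5 : ∀ {o ℓ e : Level} (C : Category o ℓ e) (FP : FiniteProducts C) →
    WeakEqualisers C →
    (∀ (Y : Category.Obj C) → IsChoiceObject C (FiniteProducts.terminal FP) Y) →
    Elemental C (FiniteProducts.terminal FP)
lemma3p5 C FP WE choice = strongGenerator sep choice , sep
  where
  open Elements C (FiniteProducts.terminal FP)
  sep : Separating C (FiniteProducts.terminal FP)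
  sep = separating WE choice
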